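{- Let $(G,\mathcal{T},k)$ be an instance of \textsc{Steiner Tree} and suppose $G[\mathcal{T}]$ has a connected component $C$ with more than one vertex. Let $G/V(C)$ be the graph obtained from $G$ by contracting $V(C)$ into a single vertex $v_C$. Then $(G,\mathcal{T},k)$ is a yes-instance if and only if $(G/V(C),(\mathcal{T}\setminus V(C))\cup\{v_C\},k-|V(C)|+1)$ is a yes-instance. Furthermore, if $G$ is chordal, the leafage of $G/V(C)$ is at most that of $G$.
   Context: \textsc{Steiner Tree}: given a graph $G$, a set $\mathcal{T}\subseteq V(G)$ of terminals and an integer $k$, decide whether $G$ has a tree (subgraph) containing all vertices of $\mathcal{T}$ and having at most $k$ vertices. The leafage of a chordal graph is the minimum number of leaves of a tree $T$ such that the graph is the intersection graph of subtrees of $T$. -}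

module Defs where

open import Data.Nat using (ℕ; zero; suc; _≤_; _≤ᵇ_)
open import Data.Integer as ℤ using (ℤ; +_)
open import Data.Fin using (Fin; zero; suc; inject₁; fromℕ; toℕ)
open import Data.Fin.Subset using (Subset; _∈_; ∣_∣; outside)
open import Data.Vec using (lookup; tabulate)
open import Data.Bool using (Bool; true; false)
open import Data.List using (List; length)
open import Data.List.Membership.Propositional renaming (_∈_ to _∈ˡ_)
open import Data.List.Relation.Unary.Unique.Propositional using (Unique)
open import Data.Maybe using (Maybe; just; nothing)
open import Data.Product using (Σ; ∃; _×_; _,_; proj₁)
open import Data.Unit using (⊤)
open import Data.Empty using (⊥)
open import Function using (_⇔_)
open import Function.Definitions using (Injective)
open import Relation.Nullary using (¬_)
open import Relation.Binary.PropositionalEquality using (_≡_; _≢_)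
open import Relation.Binary.Construct.Closure.ReflexiveTransitive using (Star)

record Graph (V : Set) : Set₁ where
  field
    Adj    : V → V → Set
    sym    : ∀ {u v} → Adj u v → Adj v u
    irrefl : ∀ v → ¬ Adj v v
open Graph public

InducedAdj : ∀ {V : Set} → Graph V → (V → Set) → V → V → Set
InducedAdj G P u v = P u × P v × Adj G u v

record Cycle {V : Set} (F : V → V → Set) : Set where
  field
    len   : ℕ                       -- the cycle has suc len vertices
    long  : 2 ≤ len
    vs    : Fin (suc len) → V
    inj   : Injective _≡_ _≡_ vs
    edges : ∀ (i : Fin len) → F (vs (inject₁ i)) (vs (suc i))
    close : F (vs (fromℕ len)) (vs zero)
open Cycle public

NonConsecutive : ∀ {m : ℕ} → Fin (suc m) → Fin (suc m) → Set
NonConsecutive {m} i j =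
  i ≢ j × toℕ j ≢ suc (toℕ i) × toℕ i ≢ suc (toℕ j)
  × ¬ (toℕ i ≡ 0 × toℕ j ≡ m) × ¬ (toℕ j ≡ 0 × toℕ i ≡ m)

Chordal : ∀ {V : Set} → Graph V → Set
Chordal G = ∀ (c : Cycle (Adj G)) → 3 ≤ len c →
  Σ (Fin (suc (len c))) λ i → Σ (Fin (suc (len c))) λ j →
    NonConsecutive i j × Adj G (vs c i) (vs c j)

IsTreeOn : ∀ {V : Set} → (V → Set) → (V → V → Set) → Set
IsTreeOn {V} P F =
  (∀ {u v} → F u v → P u × P v)
  × (∀ {u v} → F u v → F v u)
  × (∃ λ v → P v)
  × (∀ u v → P u → P v → Star F u v)
  × ¬ Cycle F

SteinerYes : ∀ {V : Set} → Graph V → (V → Set) → ℤ → Set₁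
SteinerYes {V} G T k =
  Σ (List V) λ S → Σ (V → V → Set) λ F →
    Unique S
    × (∀ {u v} → F u v → Adj G u v)
    × IsTreeOn (_∈ˡ S) F
    × (∀ t → T t → t ∈ˡ S)
    × (+ length S) ℤ.≤ k

IsComponent : ∀ {n} → Graph (Fin n) → Subset n → Subset n → Set
IsComponent G T C = Σ _ λ c₀ → c₀ ∈ T ×
  (∀ v → (v ∈ C) ⇔ (v ∈ T × Star (InducedAdj G (_∈ T)) c₀ v))

MoreThanOneVertex : ∀ {n} → Subset n → Set
MoreThanOneVertex C = Σ _ λ u → Σ _ λ v → u ∈ C × v ∈ C × u ≢ v

-- Contraction G / X: vertices are `nothing` (the new vertex v_X) and
-- `just (v , _)` for v ∉ X.

Outside : ∀ {n} → Subset n → Fin n → Set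
Outside X v = lookup X v ≡ outside

ContrV : ∀ {n} → Subset n → Set
ContrV {n} X = Maybe (Σ (Fin n) (Outside X))

ContrAdj : ∀ {n} → Graph (Fin n) → (X : Subset n) → ContrV X → ContrV X → Set
ContrAdj G X (just (u , _)) (just (v , _)) = Adj G u v
ContrAdj G X nothing (just (v , _)) = Σ _ λ x → x ∈ X × Adj G x v
ContrAdj G X (just (u , _)) nothing = Σ _ λ x → x ∈ X × Adj G u x
ContrAdj G X nothing nothing = ⊥

private
  contr-sym : ∀ {n} (G : Graph (Fin n)) (X : Subset n) {a b : ContrV X} →
              ContrAdj G X a b → ContrAdj G X b a
  contr-sym G X {just _} {just _} e = sym G e
  contr-sym G X {nothing} {just _} (x , x∈ , e) = x , x∈ , sym G e
  contr-sym G X {just _} {nothing} (x , x∈ , e) = x , x∈ , sym G e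
  contr-sym G X {nothing} {nothing} ()

  contr-irrefl : ∀ {n} (G : Graph (Fin n)) (X : Subset n) (a : ContrV X) →
                 ¬ ContrAdj G X a a
  contr-irrefl G X (just (u , _)) e = irrefl G u e
  contr-irrefl G X nothing ()

_/_ : ∀ {n} → Graph (Fin n) → (X : Subset n) → Graph (ContrV X)
G / X = record { Adj = ContrAdj G X ; sym = λ {a} {b} → contr-sym G X {a} {b} ; irrefl = contr-irrefl G X }

ContrTerminals : ∀ {n} → Subset n → (X : Subset n) → ContrV X → Set
ContrTerminals T X nothing = ⊤
ContrTerminals T X (just (v , _)) = v ∈ T

record HostTree (m : ℕ) : Set where
  field
    tadj    : Fin m → Fin m → Bool
    tsym    : ∀ a b → tadj a b ≡ tadj b a
    tirrefl : ∀ a → tadj a a ≡ false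
    isTree  : IsTreeOn (λ _ → ⊤) (λ a b → tadj a b ≡ true)
open HostTree public

degree : ∀ {m} → HostTree m → Fin m → ℕ
degree H a = ∣ tabulate (tadj H a) ∣

-- leaves: vertices of degree at most 1 (a one-vertex tree has one leaf)
leaves : ∀ {m} → HostTree m → ℕ
leaves H = ∣ tabulate (λ a → degree H a ≤ᵇ 1) ∣

IsSubtree : ∀ {m} → HostTree m → (Fin m → Bool) → Set
IsSubtree H s = (∃ λ a → s a ≡ true)
  × (∀ a b → s a ≡ true → s b ≡ true →
       Star (λ x y → s x ≡ true × s y ≡ true × tadj H x y ≡ true) a b)

IsTreeModel : ∀ {V : Set} {m} → Graph V → HostTree m → (V → Fin m → Bool) → Set
IsTreeModel {V} G H f =
  (∀ v → IsSubtree H (f v))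
  × (∀ u v → u ≢ v → (Adj G u v ⇔ (∃ λ a → f u a ≡ true × f v a ≡ true)))

IsLeafage : ∀ {V : Set} → Graph V → ℕ → Set
IsLeafage {V} G ℓ =
  (Σ ℕ λ m → Σ (HostTree m) λ H → Σ (V → Fin m → Bool) λ f →
     IsTreeModel G H f × leaves H ≡ ℓ)
  × (∀ m (H : HostTree m) (f : V → Fin m → Bool) → IsTreeModel G H f → ℓ ≤ leaves H)

{-# OPTIONS --safe #-}
-- Only the vertex set of a Steiner tree matters: a connected vertex set of G
-- spans a tree of G, grown one leaf at a time. A solution S contains T ⊇ C,
-- and its image under the quotient map G → G / C is connected with
-- |S| − |C| + 1 vertices.
-- Conversely, the vertices other than v_C of a solution for G / C, together
-- with C, are connected in G because C is. For the leafage, a tree model of G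
-- becomes one of G / C on the same host tree by representing v_C with the union
-- of the subtrees of the vertices of C, again a subtree since C is connected.

module Submission where

open import Defs renaming (sym to Adj-sym)
open import Data.Nat as ℕ using (ℕ; zero; suc; _≤_; z≤n; s≤s)
import Data.Nat.Properties as ℕ
open import Data.Integer as ℤ using (ℤ; +_; _-_; _+_; +≤+)
import Data.Integer.Properties as ℤₚ
open import Data.Integer.Tactic.RingSolver using (solve-∀)
open import Data.Bool using (Bool; true)
import Data.Bool as Bool
open import Data.Bool.Properties using (T-≡)
open import Data.Fin using (Fin; zero; suc; inject₁; fromℕ)
import Data.Fin.Properties as Fin
open import Data.Fin.Relation.Unary.Top using (view; ‵fromℕ; ‵inject₁)
open import Data.Fin.Subset using (Subset; _∈_; ∣_∣; inside; outside)
import Data.Fin.Subset.Properties as Subsetₚ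
open import Data.Vec using ([]; _∷_; here; there; lookup)
open import Data.Vec.Properties using ([]=⇒lookup; lookup⇒[]=)
open import Data.List using (List; []; _∷_; length; map; _++_; mapMaybe)
open import Data.List.Properties using (length-map; length-++)
open import Data.List.Membership.Propositional using (find) renaming (_∈_ to _∈ˡ_; _∉_ to _∉ˡ_)
open import Data.List.Membership.Propositional.Properties
  using (∈-∃++; ∈-++⁻; ∈-++⁺ˡ; ∈-++⁺ʳ; ∈-map⁻; ∈-map⁺)
import Data.List.Membership.DecPropositional as DecMembership
open import Data.List.Relation.Binary.Subset.Propositional using () renaming (_⊆_ to _⊆ˡ_)
open import Data.List.Relation.Unary.Any using (here; there)
open import Data.List.Relation.Unary.All as All using (All; all?)
open import Data.List.Relation.Unary.All.Properties using (¬All⇒Any¬)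
open import Data.List.Relation.Unary.AllPairs using ([]; _∷_)
open import Data.List.Relation.Unary.Unique.Propositional using (Unique)
import Data.List.Relation.Unary.Unique.Propositional.Properties as Unique
open import Data.Maybe using (Maybe; just; nothing)
import Data.Maybe.Properties as Maybe
open import Data.Product using (Σ; ∃; ∃₂; _×_; _,_; proj₁; proj₂)
open import Data.Sum using (_⊎_; inj₁; inj₂)
open import Data.Unit using (tt)
open import Data.Empty using (⊥; ⊥-elim)
open import Function using (_⇔_; mk⇔; Equivalence; id; _∘_)
open import Relation.Nullary using (¬_; Dec; yes; no)
open import Relation.Nullary.Decidable using (_×-dec_; isYes; toWitness; fromWitness; map′)
open import Relation.Unary using (Decidable)
open import Relation.Binary.Definitions using (DecidableEquality)
open import Relation.Binary.PropositionalEquality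
open import Relation.Binary.Construct.Closure.ReflexiveTransitive
  using (Star; ε; _◅_; _◅◅_; gmap; reverse; kleisliStar)
open import Axiom.UniquenessOfIdentityProofs using (module Decidable⇒UIP)

module _ {A : Set} where

  unique-⊆⇒length≤ : {xs ys : List A} → Unique xs → xs ⊆ˡ ys → length xs ≤ length ys
  unique-⊆⇒length≤ [] _ = z≤n
  unique-⊆⇒length≤ {x ∷ xs} (x∉xs ∷ xs!) xs⊆ys with ∈-∃++ (xs⊆ys (here refl))
  ... | as , bs , refl = begin
      suc (length xs)             ≤⟨ s≤s (unique-⊆⇒length≤ xs! xs⊆as++bs) ⟩
      suc (length (as ++ bs))     ≡⟨ cong suc (length-++ as) ⟩
      suc (length as ℕ.+ length bs) ≡⟨ ℕ.+-suc (length as) (length bs) ⟨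
      length as ℕ.+ length (x ∷ bs) ≡⟨ length-++ as ⟨
      length (as ++ x ∷ bs)       ∎
    where
    open ℕ.≤-Reasoning
    xs⊆as++bs : xs ⊆ˡ as ++ bs
    xs⊆as++bs z∈xs with ∈-++⁻ as (xs⊆ys (there z∈xs))
    ... | inj₁ z∈as        = ∈-++⁺ˡ z∈as
    ... | inj₂ (here refl) = ⊥-elim (All.lookup x∉xs z∈xs refl)
    ... | inj₂ (there z∈bs) = ∈-++⁺ʳ as z∈bs

module _ {A B : Set} (f : A → Maybe B) where

  ∈-mapMaybe⁺ : ∀ {xs x y} → x ∈ˡ xs → f x ≡ just y → y ∈ˡ mapMaybe f xs
  ∈-mapMaybe⁺ {x ∷ xs} (here refl) fx≡y rewrite fx≡y = here refl
  ∈-mapMaybe⁺ {x ∷ xs} (there x∈xs) fx≡y with f x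
  ... | nothing = ∈-mapMaybe⁺ x∈xs fx≡y
  ... | just _  = there (∈-mapMaybe⁺ x∈xs fx≡y)

  ∈-mapMaybe⁻ : ∀ {xs y} → y ∈ˡ mapMaybe f xs → ∃ λ x → x ∈ˡ xs × f x ≡ just y
  ∈-mapMaybe⁻ {x ∷ xs} y∈ with f x in fx≡
  ... | nothing = let x′ , x′∈ , eq = ∈-mapMaybe⁻ y∈ in x′ , there x′∈ , eq
  ∈-mapMaybe⁻ {x ∷ xs} (here refl) | just _ = x , here refl , fx≡
  ∈-mapMaybe⁻ {x ∷ xs} (there y∈) | just _ =
    let x′ , x′∈ , eq = ∈-mapMaybe⁻ y∈ in x′ , there x′∈ , eq

  mapMaybe-unique : (∀ {x x′ y} → f x ≡ just y → f x′ ≡ just y → x ≡ x′) →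
                    ∀ {xs} → Unique xs → Unique (mapMaybe f xs)
  mapMaybe-unique f-inj {[]} [] = []
  mapMaybe-unique f-inj {x ∷ xs} (x∉xs ∷ xs!) with f x in fx≡
  ... | nothing = mapMaybe-unique f-inj xs!
  ... | just y  = All.tabulate y∉ ∷ mapMaybe-unique f-inj xs!
    where
    y∉ : ∀ {z} → z ∈ˡ mapMaybe f xs → y ≢ z
    y∉ z∈ refl = let x′ , x′∈ , fx′≡ = ∈-mapMaybe⁻ z∈ in
      All.lookup x∉xs x′∈ (f-inj fx≡ fx′≡)

elements : ∀ {n} → Subset n → List (Fin n)
elements []            = []
elements (inside ∷ p)  = zero ∷ map suc (elements p)
elements (outside ∷ p) = map suc (elements p)

length-elements : ∀ {n} (p : Subset n) → length (elements p) ≡ ∣ p ∣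
length-elements []            = refl
length-elements (inside ∷ p)  = cong suc (trans (length-map suc (elements p)) (length-elements p))
length-elements (outside ∷ p) = trans (length-map suc (elements p)) (length-elements p)

∈-elements⁺ : ∀ {n} {p : Subset n} {x} → x ∈ p → x ∈ˡ elements p
∈-elements⁺ {p = inside ∷ p}  here        = here refl
∈-elements⁺ {p = inside ∷ p}  (there x∈p) = there (∈-map⁺ suc (∈-elements⁺ x∈p))
∈-elements⁺ {p = outside ∷ p} (there x∈p) = ∈-map⁺ suc (∈-elements⁺ x∈p)

∈-elements⁻ : ∀ {n} (p : Subset n) {x} → x ∈ˡ elements p → x ∈ p
∈-elements⁻ (inside ∷ p) (here refl) = here
∈-elements⁻ (inside ∷ p) (there x∈) with ∈-map⁻ suc x∈
... | _ , y∈ , refl = there (∈-elements⁻ p y∈)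
∈-elements⁻ (outside ∷ p) x∈ with ∈-map⁻ suc x∈
... | _ , y∈ , refl = there (∈-elements⁻ p y∈)

elements-unique : ∀ {n} (p : Subset n) → Unique (elements p)
elements-unique []            = []
elements-unique (inside ∷ p)  =
  All.tabulate zero∉ ∷ Unique.map⁺ Fin.suc-injective (elements-unique p)
  where
  zero∉ : ∀ {y} → y ∈ˡ map suc (elements p) → zero ≢ y
  zero∉ y∈ with ∈-map⁻ suc y∈
  ... | _ , _ , refl = λ ()
elements-unique (outside ∷ p) = Unique.map⁺ Fin.suc-injective (elements-unique p)

module _ {V : Set} {F : V → V → Set} where

  cycle-neighbours : (c : Cycle F) (i : Fin (suc (len c))) →
                     ∃₂ λ j k → j ≢ k × F (vs c i) (vs c j) × F (vs c k) (vs c i)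
  cycle-neighbours record { len = zero ; long = () }
  cycle-neighbours record { len = suc zero ; long = s≤s () }
  cycle-neighbours record { len = suc (suc L) ; edges = e ; close = cl } zero =
    suc zero , fromℕ _ , (λ ()) , e zero , cl
  cycle-neighbours record { len = suc (suc L) ; edges = e ; close = cl } (suc i) with view i
  ... | ‵fromℕ     = zero , inject₁ i , (λ ()) , cl , e i
  ... | ‵inject₁ j = suc (suc j) , inject₁ (inject₁ j) , 2+j≢j , e (suc j) , e (inject₁ j)
    where
    2+j≢j : ∀ {m} {j : Fin m} → suc (suc j) ≢ inject₁ (inject₁ j)
    2+j≢j {j = zero}  ()
    2+j≢j {j = suc j} eq = 2+j≢j (Fin.suc-injective eq)

bound-shift : ∀ c r (k : ℤ) → (+ (c ℕ.+ r) ℤ.≤ k) ⇔ (+ suc r ℤ.≤ k - + c + + 1)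
bound-shift c r k = mk⇔
  (λ le → subst₂ ℤ._≤_ size≡ bound≡ (ℤₚ.+-monoˡ-≤ d le))
  (λ le → subst₂ ℤ._≤_ (cancel _ d) (cancel k d)
            (ℤₚ.+-monoˡ-≤ (ℤ.- d) (subst₂ ℤ._≤_ (sym size≡) (sym bound≡) le)))
  where
  d : ℤ
  d = + 1 - + c
  cancel : ∀ x y → x + y + ℤ.- y ≡ x
  cancel = solve-∀
  size≡ : + (c ℕ.+ r) + d ≡ + suc r
  size≡ rewrite ℤₚ.pos-+ c r | ℤₚ.pos-+ 1 r = shifted (+ c) (+ r)
    where
    shifted : ∀ x y → x + y + (+ 1 - x) ≡ + 1 + y
    shifted = solve-∀
  bound≡ : k + d ≡ k - + c + + 1
  bound≡ = shifted k (+ c)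
    where
    shifted : ∀ x y → x + (+ 1 - y) ≡ x - y + + 1
    shifted = solve-∀

crossing-edge : ∀ {V : Set} {R : V → V → Set} {P : V → Set} → Decidable P →
                ∀ {x y} → Star R x y → ¬ P x → P y → ∃₂ λ a b → R a b × ¬ P a × P b
crossing-edge P? ε ¬Px Py = ⊥-elim (¬Px Py)
crossing-edge P? (_◅_ {j = z} r rs) ¬Px Py with P? z
... | yes Pz = _ , z , r , ¬Px , Pz
... | no ¬Pz = crossing-edge P? rs ¬Pz Py

Connected : ∀ {V : Set} → Graph V → List V → Set
Connected G S = ∀ {x y} → x ∈ˡ S → y ∈ˡ S → Star (InducedAdj G (_∈ˡ S)) x y

module SpanningTree {V : Set} (_≟_ : DecidableEquality V) (G : Graph V) where

  open DecMembership _≟_ using (_∈?_)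

  data Grown (r : V) : List V → Set where
    root   : Grown r (r ∷ [])
    attach : ∀ {L u v} → Grown r L → u ∉ˡ L → v ∈ˡ L → Adj G u v → Grown r (u ∷ L)

  Edge : ∀ {r L} → Grown r L → V → V → Set
  Edge root x y = ⊥
  Edge (attach {u = u} {v} g _ _ _) x y = (x ≡ u × y ≡ v) ⊎ (x ≡ v × y ≡ u) ⊎ Edge g x y

  module _ {r : V} where

    Edge⇒Adj : ∀ {L} (g : Grown r L) {x y} → Edge g x y → Adj G x y
    Edge⇒Adj (attach g _ _ e) (inj₁ (refl , refl))        = e
    Edge⇒Adj (attach g _ _ e) (inj₂ (inj₁ (refl , refl))) = Adj-sym G e
    Edge⇒Adj (attach g _ _ _) (inj₂ (inj₂ xy))            = Edge⇒Adj g xy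

    Edge⇒∈ : ∀ {L} (g : Grown r L) {x y} → Edge g x y → x ∈ˡ L × y ∈ˡ L
    Edge⇒∈ (attach g _ v∈ _) (inj₁ (refl , refl))        = here refl , there v∈
    Edge⇒∈ (attach g _ v∈ _) (inj₂ (inj₁ (refl , refl))) = there v∈ , here refl
    Edge⇒∈ (attach g _ _ _)  (inj₂ (inj₂ xy))            =
      let x∈ , y∈ = Edge⇒∈ g xy in there x∈ , there y∈

    Edge-sym : ∀ {L} (g : Grown r L) {x y} → Edge g x y → Edge g y x
    Edge-sym (attach g _ _ _) (inj₁ (x≡ , y≡))        = inj₂ (inj₁ (y≡ , x≡))
    Edge-sym (attach g _ _ _) (inj₂ (inj₁ (x≡ , y≡))) = inj₁ (y≡ , x≡)
    Edge-sym (attach g _ _ _) (inj₂ (inj₂ xy))        = inj₂ (inj₂ (Edge-sym g xy))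

    root-∈ : ∀ {L} → Grown r L → r ∈ˡ L
    root-∈ root               = here refl
    root-∈ (attach g _ _ _) = there (root-∈ g)

    Grown-unique : ∀ {L} → Grown r L → Unique L
    Grown-unique root               = All.[] ∷ []
    Grown-unique (attach g u∉ _ _) =
      All.tabulate (λ x∈ u≡x → u∉ (subst (_∈ˡ _) (sym u≡x) x∈)) ∷ Grown-unique g

    path-to-root : ∀ {L} (g : Grown r L) {x} → x ∈ˡ L → Star (Edge g) x r
    path-to-root root (here refl) = ε
    path-to-root (attach g _ v∈ _) (here refl) =
      inj₁ (refl , refl) ◅ gmap id (inj₂ ∘ inj₂) (path-to-root g v∈)
    path-to-root (attach g _ _ _)  (there x∈)  = gmap id (inj₂ ∘ inj₂) (path-to-root g x∈)

    -- The newest vertex u has the single neighbour v, but every vertex of a cycle has two.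
    Edge-acyclic : ∀ {L} (g : Grown r L) → ¬ Cycle (Edge g)
    Edge-acyclic root c = close c
    Edge-acyclic {_ ∷ L} (attach {u = u} {v} g u∉ v∈ e) c with Fin.any? (λ i → vs c i ≟ u)
    ... | yes (i , i↦u) =
      let j , k , j≢k , ij , ki = cycle-neighbours c i
      in j≢k (inj c (trans (from-u (subst (λ z → Edge g′ z (vs c j)) i↦u ij))
                           (sym (to-u (subst (Edge g′ (vs c k)) i↦u ki)))))
      where
      g′ : Grown r (u ∷ L)
      g′ = attach g u∉ v∈ e
      from-u : ∀ {x} → Edge g′ u x → x ≡ v
      from-u (inj₁ (_ , x≡v))            = x≡v
      from-u (inj₂ (inj₁ (refl , refl))) = ⊥-elim (u∉ v∈)
      from-u (inj₂ (inj₂ ux))            = ⊥-elim (u∉ (proj₁ (Edge⇒∈ g ux)))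
      to-u : ∀ {x} → Edge g′ x u → x ≡ v
      to-u (inj₁ (refl , refl))        = ⊥-elim (u∉ v∈)
      to-u (inj₂ (inj₁ (x≡v , _)))     = x≡v
      to-u (inj₂ (inj₂ xu))            = ⊥-elim (u∉ (proj₂ (Edge⇒∈ g xu)))
    ... | no u∉c = Edge-acyclic g record
      { len = len c ; long = long c ; vs = vs c ; inj = inj c
      ; edges = λ i → old-edge (edges c i) (u∉c ∘ (_ ,_)) (u∉c ∘ (_ ,_))
      ; close = old-edge (close c) (u∉c ∘ (_ ,_)) (u∉c ∘ (_ ,_)) }
      where
      old-edge : ∀ {x y} → Edge (attach g u∉ v∈ e) x y → x ≢ u → y ≢ u → Edge g x y
      old-edge (inj₁ (x≡u , _))        x≢u _   = ⊥-elim (x≢u x≡u)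
      old-edge (inj₂ (inj₁ (_ , y≡u))) _   y≢u = ⊥-elim (y≢u y≡u)
      old-edge (inj₂ (inj₂ xy))        _   _   = xy

  module _ {S : List V} {r : V} (connected : Connected G S) (r∈S : r ∈ˡ S) where

    -- The fuel bounds the number of attachments: a grown list is unique and lies in S.
    grow : ∀ fuel {L} → Grown r L → L ⊆ˡ S → length S ≤ length L ℕ.+ fuel →
           ∃ λ L′ → Grown r L′ × L′ ⊆ˡ S × S ⊆ˡ L′
    grow fuel {L} g L⊆S bound with all? (_∈? L) S
    ... | yes S⊆L = L , g , L⊆S , All.lookup S⊆L
    ... | no S⊈L with find (¬All⇒Any¬ (_∈? L) S S⊈L)
    ... | s , s∈S , s∉L with crossing-edge (_∈? L) (connected s∈S r∈S) s∉L (root-∈ g)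
    ... | a , b , (a∈S , _ , e) , a∉L , b∈L =
      attach-then-grow fuel (attach g a∉L b∈L e) (λ { (here refl) → a∈S ; (there x∈) → L⊆S x∈ }) bound
      where
      attach-then-grow : ∀ fuel → Grown r (a ∷ L) → a ∷ L ⊆ˡ S → length S ≤ length L ℕ.+ fuel →
                         ∃ λ L′ → Grown r L′ × L′ ⊆ˡ S × S ⊆ˡ L′
      attach-then-grow zero g′ aL⊆S bound = ⊥-elim (ℕ.1+n≰n (begin
        suc (length L) ≤⟨ unique-⊆⇒length≤ (Grown-unique g′) aL⊆S ⟩
        length S       ≤⟨ bound ⟩
        length L ℕ.+ 0 ≡⟨ ℕ.+-identityʳ _ ⟩
        length L       ∎))
        where open ℕ.≤-Reasoning
      attach-then-grow (suc fuel) g′ aL⊆S bound =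
        grow fuel g′ aL⊆S (ℕ.≤-trans bound (ℕ.≤-reflexive (ℕ.+-suc _ fuel)))

    spanning-tree : Σ (V → V → Set) λ F → (∀ {u v} → F u v → Adj G u v) × IsTreeOn (_∈ˡ S) F
    spanning-tree =
      let L , g , L⊆S , S⊆L = grow (length S) root (λ { (here refl) → r∈S }) (ℕ.n≤1+n _)
      in Edge g , Edge⇒Adj g ,
         (λ xy → let x∈ , y∈ = Edge⇒∈ g xy in L⊆S x∈ , L⊆S y∈) ,
         Edge-sym g ,
         (r , r∈S) ,
         (λ x y x∈ y∈ → path-to-root g (S⊆L x∈) ◅◅ reverse (Edge-sym g) (path-to-root g (S⊆L y∈))) ,
         Edge-acyclic g

module _ {V : Set} {G : Graph V} {P : V → Set} where

  InducedAdj-sym : ∀ {x y} → InducedAdj G P x y → InducedAdj G P y x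
  InducedAdj-sym (Px , Py , e) = Py , Px , Adj-sym G e

module _ {V W : Set} {G : Graph V} {H : Graph W} {S : List V} {S′ : List W} where

  connected-image : (f : V → W) →
    (∀ {x y} → x ∈ˡ S → y ∈ˡ S → Adj G x y → Star (InducedAdj H (_∈ˡ S′)) (f x) (f y)) →
    (∀ {y} → y ∈ˡ S′ → ∃ λ x → x ∈ˡ S × Star (InducedAdj H (_∈ˡ S′)) (f x) y) →
    Connected G S → Connected H S′
  connected-image f step reach S-connected y₁∈ y₂∈ =
    let x₁ , x₁∈ , p₁ = reach y₁∈
        x₂ , x₂∈ , p₂ = reach y₂∈
    in reverse (InducedAdj-sym {G = H} {P = _∈ˡ S′}) p₁
       ◅◅ kleisliStar f (λ (a∈ , b∈ , e) → step a∈ b∈ e) (S-connected x₁∈ x₂∈)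
       ◅◅ p₂

record ConnectedCover {V : Set} (G : Graph V) (T : V → Set) (k : ℤ) : Set where
  field
    vertices  : List V
    unique    : Unique vertices
    connected : Connected G vertices
    covers    : ∀ t → T t → t ∈ˡ vertices
    bounded   : + length vertices ℤ.≤ k

module _ {V : Set} {G : Graph V} {T : V → Set} {k : ℤ} where

  steinerYes⇒cover : SteinerYes G T k → ConnectedCover G T k
  steinerYes⇒cover (S , F , S! , F⊆G , (F⇒∈ , _ , _ , F-connected , _) , covers , bounded) = record
    { vertices  = S
    ; unique    = S!
    ; connected = λ x∈ y∈ →
        gmap id (λ f → let a∈ , b∈ = F⇒∈ f in a∈ , b∈ , F⊆G f) (F-connected _ _ x∈ y∈)
    ; covers    = covers
    ; bounded   = bounded
    }

  cover⇒steinerYes : DecidableEquality V → (K : ConnectedCover G T k) →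
                     ∀ {r} → r ∈ˡ ConnectedCover.vertices K → SteinerYes G T k
  cover⇒steinerYes _≟_ K r∈ =
    let F , F⊆G , tree = SpanningTree.spanning-tree _≟_ G connected r∈
    in vertices , F , unique , F⊆G , tree , covers , bounded
    where open ConnectedCover K

module Component {n} {G : Graph (Fin n)} {T C : Subset n} (component : IsComponent G T C) where

  root : Fin n
  root = proj₁ component

  private
    membership : ∀ x → x ∈ C ⇔ (x ∈ T × Star (InducedAdj G (_∈ T)) root x)
    membership = proj₂ (proj₂ component)

  ⊆T : ∀ {x} → x ∈ C → x ∈ T
  ⊆T x∈C = proj₁ (Equivalence.to (membership _) x∈C)

  root∈ : root ∈ C
  root∈ = Equivalence.from (membership root) (proj₁ (proj₂ component) , ε)

  private
    stays-in-C : ∀ {x y} → x ∈ C → Star (InducedAdj G (_∈ T)) x y → Star (InducedAdj G (_∈ C)) x y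
    stays-in-C x∈C ε = ε
    stays-in-C {x} x∈C (xz@(_ , z∈T , e) ◅ zy) =
      let root⇝x = proj₂ (Equivalence.to (membership x) x∈C)
          z∈C    = Equivalence.from (membership _) (z∈T , root⇝x ◅◅ xz ◅ ε)
      in (x∈C , z∈C , e) ◅ stays-in-C z∈C zy

  connected : ∀ {x} → x ∈ C → Star (InducedAdj G (_∈ C)) root x
  connected x∈C = stays-in-C root∈ (proj₂ (Equivalence.to (membership _) x∈C))

module Contraction {n} (G : Graph (Fin n)) (C : Subset n) where

  Retained : Set
  Retained = Σ (Fin n) (Outside C)

  Outside-irrelevant : ∀ {x} (p q : Outside C x) → p ≡ q
  Outside-irrelevant = Decidable⇒UIP.≡-irrelevant Bool._≟_

  proj₁-injective : ∀ {a b : Retained} → proj₁ a ≡ proj₁ b → a ≡ b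
  proj₁-injective {x , p} {.x , q} refl = cong (x ,_) (Outside-irrelevant p q)

  _≟ᶜ_ : DecidableEquality (ContrV C)
  _≟ᶜ_ = Maybe.≡-dec λ a b → map′ proj₁-injective (cong proj₁) (proj₁ a Fin.≟ proj₁ b)

  ∈⇒¬Outside : ∀ {x} → x ∈ C → ¬ Outside C x
  ∈⇒¬Outside x∈C x-out with trans (sym ([]=⇒lookup x∈C)) x-out
  ... | ()

  ∈-Outside-≢ : ∀ {x v} → x ∈ C → Outside C v → x ≢ v
  ∈-Outside-≢ x∈C v-out refl = ∈⇒¬Outside x∈C v-out

  classify : ∀ x b → lookup C x ≡ b → ContrV C
  classify x inside  _   = nothing
  classify x outside out = just (x , out)

  π : Fin n → ContrV C
  π x = classify x (lookup C x) refl

  π-spec : ∀ x → (x ∈ C × π x ≡ nothing) ⊎ (Σ (Outside C x) λ p → π x ≡ just (x , p))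
  π-spec x = classify-spec (lookup C x) refl
    where
    classify-spec : ∀ b (eq : lookup C x ≡ b) →
      (x ∈ C × classify x b eq ≡ nothing) ⊎ (Σ (Outside C x) λ p → classify x b eq ≡ just (x , p))
    classify-spec inside  eq = inj₁ (lookup⇒[]= x C eq , refl)
    classify-spec outside eq = inj₂ (eq , refl)

  π-inside : ∀ {x} → x ∈ C → π x ≡ nothing
  π-inside {x} x∈C with π-spec x
  ... | inj₁ (_ , πx≡) = πx≡
  ... | inj₂ (p , _)   = ⊥-elim (∈⇒¬Outside x∈C p)

  π-outside : ∀ {x} (p : Outside C x) → π x ≡ just (x , p)
  π-outside {x} p with π-spec x
  ... | inj₁ (x∈C , _)   = ⊥-elim (∈⇒¬Outside x∈C p)
  ... | inj₂ (q , πx≡) = trans πx≡ (cong (λ q → just (x , q)) (Outside-irrelevant q p))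

  π-just : ∀ {x y} → π x ≡ just y → x ≡ proj₁ y
  π-just {x} πx≡ with π-spec x
  ... | inj₁ (_ , πx≡′) with trans (sym πx≡′) πx≡
  ...   | ()
  π-just {x} πx≡ | inj₂ (p , πx≡′) = cong proj₁ (Maybe.just-injective (trans (sym πx≡′) πx≡))

  π-adj : ∀ {x y} → Adj G x y → π x ≡ π y ⊎ Adj (G / C) (π x) (π y)
  π-adj {x} {y} e with π-spec x | π-spec y
  ... | inj₁ (_ , πx≡) | inj₁ (_ , πy≡)   = inj₁ (trans πx≡ (sym πy≡))
  ... | inj₁ (x∈ , πx≡) | inj₂ (_ , πy≡) rewrite πx≡ | πy≡ = inj₂ (x , x∈ , e)
  ... | inj₂ (_ , πx≡) | inj₁ (y∈ , πy≡) rewrite πx≡ | πy≡ = inj₂ (y , y∈ , e)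
  ... | inj₂ (_ , πx≡) | inj₂ (_ , πy≡) rewrite πx≡ | πy≡ = inj₂ e

  contracted : List Retained → List (ContrV C)
  contracted R = nothing ∷ map just R

  expanded : List Retained → List (Fin n)
  expanded R = elements C ++ map proj₁ R

  contracted-unique : ∀ {R} → Unique R → Unique (contracted R)
  contracted-unique R! = All.tabulate nothing∉ ∷ Unique.map⁺ Maybe.just-injective R!
    where
    nothing∉ : ∀ {R z} → z ∈ˡ map just R → nothing ≢ z
    nothing∉ z∈ with ∈-map⁻ just z∈
    ... | _ , _ , refl = λ ()

  expanded-unique : ∀ {R} → Unique R → Unique (expanded R)
  expanded-unique R! = Unique.++⁺ (elements-unique C) (Unique.map⁺ proj₁-injective R!) disjoint
    where
    disjoint : ∀ {R x} → ¬ (x ∈ˡ elements C × x ∈ˡ map proj₁ R)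
    disjoint (x∈C , x∈R) with ∈-map⁻ proj₁ x∈R
    ... | (_ , p) , _ , refl = ∈⇒¬Outside (∈-elements⁻ C x∈C) p

  length-expanded : ∀ R → length (expanded R) ≡ ∣ C ∣ ℕ.+ length R
  length-expanded R = begin
    length (elements C ++ map proj₁ R)
      ≡⟨ length-++ (elements C) ⟩
    length (elements C) ℕ.+ length (map proj₁ R)
      ≡⟨ cong₂ ℕ._+_ (length-elements C) (length-map proj₁ R) ⟩
    ∣ C ∣ ℕ.+ length R
      ∎
    where open ≡-Reasoning

  module _ {c₀} (c₀∈C : c₀ ∈ C) where

    contract-cover : ∀ {T : Subset n} {k} → (∀ {x} → x ∈ C → x ∈ T) →
      ConnectedCover G (_∈ T) k → ConnectedCover (G / C) (ContrTerminals T C) (k - + ∣ C ∣ + + 1)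
    contract-cover {T} {k} C⊆T K = record
      { vertices  = contracted R
      ; unique    = contracted-unique R!
      ; connected = connected-image {G = G} {H = G / C} π step reach K.connected
      ; covers    = covers
      ; bounded   = subst (λ l → + suc l ℤ.≤ _) (sym (length-map just R))
                      (Equivalence.to (bound-shift ∣ C ∣ (length R) k) (ℤₚ.≤-trans (+≤+ size) K.bounded))
      }
      where
      module K = ConnectedCover K

      S : List (Fin n)
      S = K.vertices

      R : List Retained
      R = mapMaybe π S

      Path : ContrV C → ContrV C → Set
      Path = Star (InducedAdj (G / C) (_∈ˡ contracted R))

      R! : Unique R
      R! = mapMaybe-unique π (λ πx≡ πx′≡ → trans (π-just πx≡) (sym (π-just πx′≡))) K.unique

      π-∈ : ∀ {x} → x ∈ˡ S → π x ∈ˡ contracted R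
      π-∈ {x} x∈S with π-spec x
      ... | inj₁ (_ , πx≡) rewrite πx≡ = here refl
      ... | inj₂ (_ , πx≡) rewrite πx≡ = there (∈-map⁺ just (∈-mapMaybe⁺ π x∈S πx≡))

      ≡⇒Star : ∀ {a b} → a ≡ b → Path a b
      ≡⇒Star refl = ε

      step : ∀ {x y} → x ∈ˡ S → y ∈ˡ S → Adj G x y → Path (π x) (π y)
      step {x} x∈S y∈S e with π-adj e
      ... | inj₁ πx≡πy = ≡⇒Star πx≡πy
      ... | inj₂ e′    = (π-∈ x∈S , π-∈ y∈S , e′) ◅ ε

      reach : ∀ {y} → y ∈ˡ contracted R → ∃ λ x → x ∈ˡ S × Path (π x) y
      reach (here refl) = c₀ , K.covers c₀ (C⊆T c₀∈C) , ≡⇒Star (π-inside c₀∈C)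
      reach (there y∈) with ∈-map⁻ just y∈
      ... | y , y∈R , refl =
        let x , x∈S , πx≡ = ∈-mapMaybe⁻ π y∈R in x , x∈S , ≡⇒Star πx≡

      covers : ∀ t → ContrTerminals T C t → t ∈ˡ contracted R
      covers nothing        _   = here refl
      covers (just (x , p)) x∈T = there (∈-map⁺ just (∈-mapMaybe⁺ π (K.covers x x∈T) (π-outside p)))

      expanded⊆S : expanded R ⊆ˡ S
      expanded⊆S x∈ with ∈-++⁻ (elements C) x∈
      ... | inj₁ x∈C = K.covers _ (C⊆T (∈-elements⁻ C x∈C))
      ... | inj₂ x∈R with ∈-map⁻ proj₁ x∈R
      ... | y , y∈R , refl =
        let x′ , x′∈S , πx′≡ = ∈-mapMaybe⁻ π y∈R in subst (_∈ˡ S) (π-just πx′≡) x′∈S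

      size : ∣ C ∣ ℕ.+ length R ≤ length S
      size = subst (_≤ length S) (length-expanded R) (unique-⊆⇒length≤ (expanded-unique R!) expanded⊆S)

    module _ (C-connected : ∀ {x} → x ∈ C → Star (InducedAdj G (_∈ C)) c₀ x) where

      expand-cover : ∀ {T : Subset n} {k} →
        ConnectedCover (G / C) (ContrTerminals T C) (k - + ∣ C ∣ + + 1) → ConnectedCover G (_∈ T) k
      expand-cover {T} {k} K′ = record
        { vertices  = expanded R
        ; unique    = expanded-unique R!
        ; connected = connected-image {G = G / C} {H = G} representative step reach K′.connected
        ; covers    = covers
        ; bounded   = subst (λ l → + l ℤ.≤ k) (sym (length-expanded R))
                        (Equivalence.from (bound-shift ∣ C ∣ (length R) k)
                          (ℤₚ.≤-trans (+≤+ size) K′.bounded))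
        }
        where
        module K′ = ConnectedCover K′

        S′ : List (ContrV C)
        S′ = K′.vertices

        R : List Retained
        R = mapMaybe id S′

        R! : Unique R
        R! = mapMaybe-unique id (λ x≡ x′≡ → trans x≡ (sym x′≡)) K′.unique

        representative : ContrV C → Fin n
        representative nothing        = c₀
        representative (just (x , _)) = x

        Path : Fin n → Fin n → Set
        Path = Star (InducedAdj G (_∈ˡ expanded R))

        C⊆expanded : ∀ {x} → x ∈ C → x ∈ˡ expanded R
        C⊆expanded = ∈-++⁺ˡ ∘ ∈-elements⁺

        just∈⇒∈ : ∀ {y} → just y ∈ˡ S′ → proj₁ y ∈ˡ expanded R
        just∈⇒∈ y∈ = ∈-++⁺ʳ (elements C) (∈-map⁺ proj₁ (∈-mapMaybe⁺ id y∈ refl))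

        path-in-C : ∀ {x} → x ∈ C → Path c₀ x
        path-in-C x∈C =
          gmap id (λ (a∈ , b∈ , e) → C⊆expanded a∈ , C⊆expanded b∈ , e) (C-connected x∈C)

        step : ∀ {a b} → a ∈ˡ S′ → b ∈ˡ S′ → Adj (G / C) a b →
               Path (representative a) (representative b)
        step {just _}  {just _}  a∈ b∈ e = (just∈⇒∈ a∈ , just∈⇒∈ b∈ , e) ◅ ε
        step {just _}  {nothing} a∈ _  (z , z∈C , e) =
          (just∈⇒∈ a∈ , C⊆expanded z∈C , e) ◅ reverse (InducedAdj-sym {G = G}) (path-in-C z∈C)
        step {nothing} {just _}  _  b∈ (z , z∈C , e) =
          path-in-C z∈C ◅◅ (C⊆expanded z∈C , just∈⇒∈ b∈ , e) ◅ ε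

        reach : ∀ {x} → x ∈ˡ expanded R → ∃ λ a → a ∈ˡ S′ × Path (representative a) x
        reach x∈ with ∈-++⁻ (elements C) x∈
        ... | inj₁ x∈C = nothing , K′.covers nothing tt , path-in-C (∈-elements⁻ C x∈C)
        ... | inj₂ x∈R with ∈-map⁻ proj₁ x∈R
        ... | y , y∈R , refl with ∈-mapMaybe⁻ id y∈R
        ... | a , a∈ , refl = a , a∈ , ε

        covers : ∀ t → t ∈ T → t ∈ˡ expanded R
        covers t t∈T with π-spec t
        ... | inj₁ (t∈C , _) = C⊆expanded t∈C
        ... | inj₂ (p , _)   = just∈⇒∈ (K′.covers (just (t , p)) t∈T)

        contracted⊆S′ : contracted R ⊆ˡ S′
        contracted⊆S′ (here refl) = K′.covers nothing tt
        contracted⊆S′ (there y∈) with ∈-map⁻ just y∈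
        ... | y , y∈R , refl with ∈-mapMaybe⁻ id y∈R
        ... | a , a∈ , refl = a∈

        size : suc (length R) ≤ length S′
        size = subst (λ l → suc l ≤ length S′) (length-map just R)
                 (unique-⊆⇒length≤ (contracted-unique R!) contracted⊆S′)

      module _ {m} (H : HostTree m) (f : Fin n → Fin m → Bool) (model : IsTreeModel G H f) where

        private
          subtree : ∀ v → IsSubtree H (f v)
          subtree = proj₁ model

          adj⇔meet : ∀ u v → u ≢ v → Adj G u v ⇔ (∃ λ a → f u a ≡ true × f v a ≡ true)
          adj⇔meet = proj₂ model

        HostEdgeIn : (Fin m → Bool) → Fin m → Fin m → Set
        HostEdgeIn s a b = s a ≡ true × s b ≡ true × tadj H a b ≡ true

        covered? : ∀ a → Dec (∃ λ c → c ∈ C × f c a ≡ true)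
        covered? a = Fin.any? λ c → c Subsetₚ.∈? C ×-dec f c a Bool.≟ true

        union : Fin m → Bool
        union a = isYes (covered? a)

        union-intro : ∀ {c a} → c ∈ C → f c a ≡ true → union a ≡ true
        union-intro c∈C fca = Equivalence.to T-≡ (fromWitness {a? = covered? _} (_ , c∈C , fca))

        union-elim : ∀ {a} → union a ≡ true → ∃ λ c → c ∈ C × f c a ≡ true
        union-elim ua = toWitness {a? = covered? _} (Equivalence.from T-≡ ua)

        adj⇒meet : ∀ {u v} → Adj G u v → ∃ λ a → f u a ≡ true × f v a ≡ true
        adj⇒meet {u} e = Equivalence.to (adj⇔meet u _ (λ { refl → irrefl G u e })) e

        widen : ∀ {c a b} → c ∈ C → Star (HostEdgeIn (f c)) a b → Star (HostEdgeIn union) a b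
        widen c∈C = gmap id (λ (p , q , t) → union-intro c∈C p , union-intro c∈C q , t)

        -- Consecutive vertices of a path in G[C] have overlapping subtrees.
        linked : ∀ {x y a b} → x ∈ C → Star (InducedAdj G (_∈ C)) x y →
                 f x a ≡ true → f y b ≡ true → Star (HostEdgeIn union) a b
        linked x∈C ε fxa fxb = widen x∈C (proj₂ (subtree _) _ _ fxa fxb)
        linked x∈C ((_ , z∈C , e) ◅ zy) fxa fyb =
          let c , fxc , fzc = adj⇒meet e
          in widen x∈C (proj₂ (subtree _) _ _ fxa fxc) ◅◅ linked z∈C zy fzc fyb

        union-subtree : IsSubtree H union
        union-subtree =
          let a₀ , fa₀ = proj₁ (subtree c₀) in
          (a₀ , union-intro c₀∈C fa₀) ,
          λ a b ua ub →
            let x , x∈C , fxa = union-elim ua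
                y , y∈C , fyb = union-elim ub
            in linked x∈C (reverse (InducedAdj-sym {G = G}) (C-connected x∈C) ◅◅ C-connected y∈C) fxa fyb

        contracted-subtrees : ContrV C → Fin m → Bool
        contracted-subtrees nothing        = union
        contracted-subtrees (just (v , _)) = f v

        adj-C⇔meet : ∀ {v} → Outside C v →
                     (∃ λ x → x ∈ C × Adj G x v) ⇔ (∃ λ a → union a ≡ true × f v a ≡ true)
        adj-C⇔meet v-out = mk⇔
          (λ (x , x∈C , e) → let a , fxa , fva = adj⇒meet e in a , union-intro x∈C fxa , fva)
          (λ (a , ua , fva) → let c , c∈C , fca = union-elim ua in
            c , c∈C , Equivalence.from (adj⇔meet c _ (∈-Outside-≢ c∈C v-out)) (a , fca , fva))

        contracted-model : IsTreeModel (G / C) H contracted-subtrees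
        contracted-model = subtree′ , adj⇔meet′
          where
          subtree′ : ∀ v → IsSubtree H (contracted-subtrees v)
          subtree′ nothing        = union-subtree
          subtree′ (just (v , _)) = subtree v

          adj⇔meet′ : ∀ u v → u ≢ v →
                      Adj (G / C) u v ⇔ (∃ λ a → contracted-subtrees u a ≡ true × contracted-subtrees v a ≡ true)
          adj⇔meet′ (just (u , _)) (just (v , _)) u≢v =
            adj⇔meet u v (λ u≡v → u≢v (cong just (proj₁-injective u≡v)))
          adj⇔meet′ nothing        (just (v , q)) _   = adj-C⇔meet q
          adj⇔meet′ (just (u , p)) nothing        _   = mk⇔
            (λ (x , x∈C , e) →
              let a , ua , fua = Equivalence.to (adj-C⇔meet p) (x , x∈C , Adj-sym G e) in a , fua , ua)
            (λ (a , fua , ua) →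
              let x , x∈C , e = Equivalence.from (adj-C⇔meet p) (a , ua , fua) in x , x∈C , Adj-sym G e)
          adj⇔meet′ nothing        nothing        u≢v = ⊥-elim (u≢v refl)

      leafage-contraction-≤ : ∀ {ℓ ℓ′} → IsLeafage G ℓ → IsLeafage (G / C) ℓ′ → ℓ′ ≤ ℓ
      leafage-contraction-≤ {ℓ′ = ℓ′} ((m , H , f , model , leaves≡ℓ) , _) (_ , minimal) =
        subst (ℓ′ ≤_) leaves≡ℓ (minimal m H (contracted-subtrees H f model) (contracted-model H f model))

lemma20 : ∀ {n} (G : Graph (Fin n)) (T : Subset n) (k : ℤ) (C : Subset n) →
          IsComponent G T C → MoreThanOneVertex C →
          (SteinerYes G (_∈ T) k
            ⇔ SteinerYes (G / C) (ContrTerminals T C) (k - + ∣ C ∣ + + 1))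
          × (Chordal G → ∀ (ℓ ℓ′ : ℕ) → IsLeafage G ℓ → IsLeafage (G / C) ℓ′ → ℓ′ ≤ ℓ)
lemma20 G T k C component _ = mk⇔ contract expand , λ _ _ _ → leafage-contraction-≤ root∈ connected
  where
  open Component {G = G} {T = T} {C = C} component
  open Contraction G C

  contract : SteinerYes G (_∈ T) k → SteinerYes (G / C) (ContrTerminals T C) (k - + ∣ C ∣ + + 1)
  contract solution =
    cover⇒steinerYes _≟ᶜ_ (contract-cover root∈ ⊆T (steinerYes⇒cover solution)) (here refl)

  expand : SteinerYes (G / C) (ContrTerminals T C) (k - + ∣ C ∣ + + 1) → SteinerYes G (_∈ T) k
  expand solution =
    cover⇒steinerYes Fin._≟_ (expand-cover root∈ connected (steinerYes⇒cover solution))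
      (∈-++⁺ˡ (∈-elements⁺ root∈))
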